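{- For all positive integers $m,n$, the sparing number of the planar grid $P_m\times P_n$ (the cartesian product of two paths) is $\varphi(P_m\times P_n)=0$.
   Context: All graphs are simple and finite. For finite sets $A,B\subseteq\mathbb{N}_0$ (non-negative integers), the sumset is $A+B=\{a+b:a\in A,b\in B\}$. An integer additive set-indexer (IASI) on a graph $G$ is an injective map $f:V(G)\to\mathcal{P}(\mathbb{N}_0)$ (assigning finite nonempty sets) such that the induced map $f^+:E(G)\to\mathcal{P}(\mathbb{N}_0)$, $f^+(uv)=f(u)+f(v)$, is also injective. An IASI $f$ is weak if $|f^+(uv)|=\max(|f(u)|,|f(v)|)$ for every edge $uv$. An edge $uv$ is mono-indexed if $|f^+(uv)|=1$. The sparing number $\varphi(G)$ is the minimum, over all weak IASIs of $G$, of the number of mono-indexed edges. The cartesian product $G_1\times G_2$ has vertex set $V(G_1)\times V(G_2)$, with $(u_1,u_2)$ adjacent to $(v_1,v_2)$ iff either $u_1=v_1$ and $u_2v_2\in E(G_2)$, or $u_2=v_2$ and $u_1v_1\in E(G_1)$. $P_n$ denotes a path. -}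

module Defs where

open import Data.Nat using (ℕ; zero; suc; _+_; _≤_; _<_; _⊔_; _≡ᵇ_)
open import Data.Nat.Properties using (_<?_) renaming (_≟_ to _≟ℕ_)
open import Data.Bool using (Bool; true; false; _∧_; _∨_; T)
open import Data.Fin using (Fin; toℕ; remQuot) renaming (_≟_ to _≟F_)
open import Data.List using (List; []; _∷_; length; filter; concatMap; map; deduplicate; allFin)
open import Data.List.Membership.Propositional using (_∈_)
open import Data.Product using (Σ; _×_; _,_; proj₁; proj₂)
open import Data.Sum using (_⊎_)
open import Relation.Binary.PropositionalEquality using (_≡_; _≢_; refl; sym)
import Data.Bool.Properties
open import Relation.Nullary using (yes; no)
open import Data.Empty using (⊥-elim)
open import Relation.Nullary.Decidable using (⌊_⌋; _×-dec_)
open import Function.Bundles using (_⇔_)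

record Graph : Set where
  field
    V       : ℕ
    adj     : Fin V → Fin V → Bool
    adj-sym : ∀ u v → adj u v ≡ adj v u
    irrefl  : ∀ u → adj u u ≡ false
open Graph public

pathAdj : ∀ {k} → Fin k → Fin k → Bool
pathAdj i j = (suc (toℕ i) ≡ᵇ toℕ j) ∨ (suc (toℕ j) ≡ᵇ toℕ i)

-- Cartesian product adjacency on Fin (V₁ * V₂) ≅ Fin V₁ × Fin V₂ (via remQuot).
pairAdj : ∀ {a b} → (Fin a → Fin a → Bool) → (Fin b → Fin b → Bool)
        → Fin a × Fin b → Fin a × Fin b → Bool
pairAdj A₁ A₂ (u₁ , u₂) (v₁ , v₂) = (⌊ u₁ ≟F v₁ ⌋ ∧ A₂ u₂ v₂) ∨ (⌊ u₂ ≟F v₂ ⌋ ∧ A₁ u₁ v₁)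

prodAdj : ∀ {a b} → (Fin a → Fin a → Bool) → (Fin b → Fin b → Bool)
        → Fin (a Data.Nat.* b) → Fin (a Data.Nat.* b) → Bool
prodAdj {a} {b} A₁ A₂ x y = pairAdj A₁ A₂ (remQuot {a} b x) (remQuot {a} b y)

-- Finite sets of ℕ are represented by lists, compared up to membership.
FinSet : Set
FinSet = List ℕ

_≈ˢ_ : FinSet → FinSet → Set
A ≈ˢ B = ∀ x → (x ∈ A) ⇔ (x ∈ B)

card : FinSet → ℕ
card A = length (deduplicate _≟ℕ_ A)

_⊕_ : FinSet → FinSet → FinSet
A ⊕ B = concatMap (λ a → map (a +_) B) A

Edge : (G : Graph) → Fin (V G) → Fin (V G) → Set
Edge G u v = T (adj G u v)

record WeakIASI (G : Graph) (f : Fin (V G) → FinSet) : Set where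
  field
    nonempty    : ∀ v → f v ≢ []
    injective   : ∀ u v → f u ≈ˢ f v → u ≡ v
    induced-inj : ∀ u v x y → Edge G u v → Edge G x y →
                  (f u ⊕ f v) ≈ˢ (f x ⊕ f y) →
                  (u ≡ x × v ≡ y) ⊎ (u ≡ y × v ≡ x)
    weak        : ∀ u v → Edge G u v → card (f u ⊕ f v) ≡ card (f u) ⊔ card (f v)

edges : (G : Graph) → List (Fin (V G) × Fin (V G))
edges G = filter (λ e → toℕ (proj₁ e) <? toℕ (proj₂ e))
            (filter (λ e → adj G (proj₁ e) (proj₂ e) Data.Bool.≟ true)
              (concatMap (λ u → map (λ v → (u , v)) (allFin (V G))) (allFin (V G))))

monoCount : (G : Graph) → (Fin (V G) → FinSet) → ℕ
monoCount G f = length (filter (λ e → card (f (proj₁ e) ⊕ f (proj₂ e)) ≟ℕ 1) (edges G))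

IsSparingNumber : Graph → ℕ → Set
IsSparingNumber G k =
  Σ (Fin (V G) → FinSet) (λ f → WeakIASI G f × monoCount G f ≡ k)
  × (∀ f → WeakIASI G f → k ≤ monoCount G f)

pathAdj-sym : ∀ {k} (i j : Fin k) → pathAdj i j ≡ pathAdj j i
pathAdj-sym i j = Data.Bool.Properties.∨-comm (suc (toℕ i) ≡ᵇ toℕ j) (suc (toℕ j) ≡ᵇ toℕ i)

sucn≡ᵇn : ∀ n → (suc n ≡ᵇ n) ≡ false
sucn≡ᵇn zero = refl
sucn≡ᵇn (suc n) = sucn≡ᵇn n

pathAdj-irrefl : ∀ {k} (i : Fin k) → pathAdj i i ≡ false
pathAdj-irrefl i rewrite sucn≡ᵇn (toℕ i) = refl

Path : ℕ → Graph
Path k = record { V = k ; adj = pathAdj ; adj-sym = pathAdj-sym ; irrefl = pathAdj-irrefl }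

≡ᵇsym : ∀ {k} (a b : Fin k) → ⌊ a ≟F b ⌋ ≡ ⌊ b ≟F a ⌋
≡ᵇsym a b with a ≟F b | b ≟F a
... | yes _ | yes _ = refl
... | no _  | no _  = refl
... | yes p | no q  = ⊥-elim (q (sym p))
... | no p  | yes q = ⊥-elim (p (sym q))

pairAdj-sym : (G₁ G₂ : Graph) → ∀ p q →
  pairAdj (adj G₁) (adj G₂) p q ≡ pairAdj (adj G₁) (adj G₂) q p
pairAdj-sym G₁ G₂ (u₁ , u₂) (v₁ , v₂)
  rewrite adj-sym G₁ u₁ v₁ | adj-sym G₂ u₂ v₂
        | ≡ᵇsym u₁ v₁ | ≡ᵇsym u₂ v₂ = refl

pairAdj-irrefl : (G₁ G₂ : Graph) → ∀ p → pairAdj (adj G₁) (adj G₂) p p ≡ false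
pairAdj-irrefl G₁ G₂ (u₁ , u₂) rewrite irrefl G₁ u₁ | irrefl G₂ u₂
  rewrite Data.Bool.Properties.∧-zeroʳ ⌊ u₁ ≟F u₁ ⌋ | Data.Bool.Properties.∧-zeroʳ ⌊ u₂ ≟F u₂ ⌋ = refl

_□_ : Graph → Graph → Graph
G₁ □ G₂ = record
  { V = V G₁ Data.Nat.* V G₂
  ; adj = prodAdj (adj G₁) (adj G₂)
  ; adj-sym = λ x y → pairAdj-sym G₁ G₂ (remQuot {V G₁} (V G₂) x) (remQuot {V G₁} (V G₂) y)
  ; irrefl = λ x → pairAdj-irrefl G₁ G₂ (remQuot {V G₁} (V G₂) x) }

Grid : ℕ → ℕ → Graph
Grid m n = Path m □ Path n

-- Colour the grid by the parity of i + j; this is a proper 2-colouring, and any graph with a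
-- proper 2-colouring has a weak IASI without mono-indexed edges. Give a vertex u of colour 0
-- the singleton {N u} and a vertex v of colour 1 the pair {v, v + 1}, where N is the number of
-- vertices. Every edge joins some u of colour 0 to some v of colour 1, so its sumset is the pair
-- {N u + v, N u + v + 1}; its cardinality is 2 = max(1, 2), and it determines N u + v, hence
-- the edge, since v < N.
module Submission where

open import Defs
open import Data.Nat using (ℕ; _≤_)

open import Data.Nat using (suc; _<_; _+_; _*_; _⊔_; _≡ᵇ_; z≤n; parity)
open import Data.Nat.Properties using (_<?_; _≟_; +-suc; m≢1+n+m; +-comm; *-cancelˡ-≡; 1+n≢n; ≡ᵇ⇒≡)
open import Data.Parity.Base as ℙ using (Parity; 0ℙ; 1ℙ)
open import Data.Parity.Properties using (p≢p⁻¹; suc-homo-⁻¹; +-cancelˡ-≡; +-cancelʳ-≡)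
open import Data.Bool using (Bool; true; false; T; _∧_) renaming (_≟_ to _≟ᵇ_)
open import Data.Bool.Properties using (T-∨; T-∧; T-≡)
open import Data.Fin using (Fin; toℕ; combine; remQuot) renaming (_≟_ to _≟F_)
open import Data.Fin.Properties using (toℕ-injective; toℕ-combine; combine-injective)
open import Data.List using (List; []; _∷_; length; filter; concatMap; map; allFin)
open import Data.List.Properties using (filter-none)
open import Data.List.Relation.Unary.All as All using (All)
open import Data.List.Relation.Unary.Any using (here; there)
open import Data.List.Membership.Propositional using (_∈_)
open import Data.List.Membership.Propositional.Properties using (∈-filter⁻)
open import Data.Product using (_×_; _,_; proj₁; proj₂; uncurry; swap)
open import Data.Sum using (_⊎_; inj₁; inj₂)
open import Data.Empty using (⊥-elim)
open import Function using (_∘_)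
open import Function.Bundles using (Equivalence)
open import Function.Properties.Equivalence using () renaming (sym to ⇔-sym)
open import Relation.Binary.PropositionalEquality
open import Relation.Nullary using (¬_; Dec)
open import Relation.Nullary.Decidable using (⌊_⌋; toWitness)

ProperColouring : (G : Graph) → (Fin (V G) → Parity) → Set
ProperColouring G c = ∀ u v → Edge G u v → c u ≢ c v

consecutive : ℕ → FinSet
consecutive k = k ∷ suc k ∷ []

card-pair : ∀ {a b} → a ≢ b → card (a ∷ b ∷ []) ≡ 2
card-pair {a} {b} a≢b with a ≡ᵇ b in a≡ᵇb
... | true  = ⊥-elim (a≢b (≡ᵇ⇒≡ a b (Equivalence.from T-≡ a≡ᵇb)))
... | false = refl

card-consecutive : ∀ k → card (consecutive k) ≡ 2
card-consecutive k = card-pair {k} (1+n≢n ∘ sym)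

singleton-⊕-consecutive : ∀ a b → (a ∷ []) ⊕ consecutive b ≡ consecutive (a + b)
singleton-⊕-consecutive a b = cong (λ x → a + b ∷ x ∷ []) (+-suc a b)

∈-singleton : ∀ {a b : ℕ} → a ∈ b ∷ [] → a ≡ b
∈-singleton (here a≡b) = a≡b

singleton-injective : ∀ {a b} → (a ∷ []) ≈ˢ (b ∷ []) → a ≡ b
singleton-injective {a} eq = ∈-singleton (Equivalence.to (eq a) (here refl))

consecutive-injective : ∀ {a b} → consecutive a ≈ˢ consecutive b → a ≡ b
consecutive-injective {a} {b} eq
  with Equivalence.to (eq a) (here refl) | Equivalence.from (eq b) (here refl)
... | here a≡b            | _                   = a≡b
... | _                   | here b≡a            = sym b≡a
... | there (here a≡1+b) | there (here b≡1+a) =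
  ⊥-elim (m≢1+n+m a (trans a≡1+b (cong suc b≡1+a)))
... | there (there ())    | _
... | _                   | there (there ())

singleton≉consecutive : ∀ a b → ¬ ((a ∷ []) ≈ˢ consecutive b)
singleton≉consecutive a b eq =
  1+n≢n {b} (trans (∈-singleton (from (there (here refl)))) (sym (∈-singleton (from (here refl)))))
  where
  from : ∀ {x} → x ∈ consecutive b → x ∈ a ∷ []
  from {x} = Equivalence.from (eq x)

parity-suc≢ : ∀ n → parity (suc n) ≢ parity n
parity-suc≢ n eq = p≢p⁻¹ (parity (suc n)) (trans eq (sym (suc-homo-⁻¹ n)))

pathAdj⇒suc : ∀ {k} {i j : Fin k} → T (pathAdj i j) → suc (toℕ i) ≡ toℕ j ⊎ suc (toℕ j) ≡ toℕ i
pathAdj⇒suc {i = i} {j} e with Equivalence.to T-∨ e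
... | inj₁ e′ = inj₁ (≡ᵇ⇒≡ (suc (toℕ i)) (toℕ j) e′)
... | inj₂ e′ = inj₂ (≡ᵇ⇒≡ (suc (toℕ j)) (toℕ i) e′)

path-properColouring : ∀ k → ProperColouring (Path k) (parity ∘ toℕ)
path-properColouring k i j e eq with pathAdj⇒suc {i = i} {j} e
... | inj₁ 1+i≡j = parity-suc≢ (toℕ i) (trans (cong parity 1+i≡j) (sym eq))
... | inj₂ 1+j≡i = parity-suc≢ (toℕ j) (trans (cong parity 1+j≡i) eq)

□-colouring : (G₁ G₂ : Graph) → (Fin (V G₁) → Parity) → (Fin (V G₂) → Parity) →
              Fin (V (G₁ □ G₂)) → Parity
□-colouring G₁ G₂ c₁ c₂ = uncurry (λ i j → c₁ i ℙ.+ c₂ j) ∘ remQuot {V G₁} (V G₂)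

pairAdj⇒ : ∀ {a b} (A₁ : Fin a → Fin a → Bool) (A₂ : Fin b → Fin b → Bool) u₁ u₂ v₁ v₂ →
           T (pairAdj A₁ A₂ (u₁ , u₂) (v₁ , v₂)) →
           (u₁ ≡ v₁ × T (A₂ u₂ v₂)) ⊎ (u₂ ≡ v₂ × T (A₁ u₁ v₁))
pairAdj⇒ A₁ A₂ u₁ u₂ v₁ v₂ e
  with Equivalence.to (T-∨ {⌊ u₁ ≟F v₁ ⌋ ∧ A₂ u₂ v₂}) e
... | inj₁ e′ = let u₁≡v₁ , e₂ = Equivalence.to (T-∧ {⌊ u₁ ≟F v₁ ⌋}) e′ in inj₁ (toWitness u₁≡v₁ , e₂)
... | inj₂ e′ = let u₂≡v₂ , e₁ = Equivalence.to (T-∧ {⌊ u₂ ≟F v₂ ⌋}) e′ in inj₂ (toWitness u₂≡v₂ , e₁)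

□-properColouring : ∀ {G₁ G₂ c₁ c₂} → ProperColouring G₁ c₁ → ProperColouring G₂ c₂ →
                    ProperColouring (G₁ □ G₂) (□-colouring G₁ G₂ c₁ c₂)
□-properColouring {G₁} {G₂} {c₁} {c₂} proper₁ proper₂ x y =
  proper-on-pairs (remQuot {V G₁} (V G₂) x) (remQuot {V G₁} (V G₂) y)
  where
  proper-on-pairs : ∀ p q → T (pairAdj (adj G₁) (adj G₂) p q) →
                    uncurry (λ i j → c₁ i ℙ.+ c₂ j) p ≢ uncurry (λ i j → c₁ i ℙ.+ c₂ j) q
  proper-on-pairs (i , j) (i′ , j′) e with pairAdj⇒ (adj G₁) (adj G₂) i j i′ j′ e
  ... | inj₁ (refl , e₂) = proper₂ j j′ e₂ ∘ +-cancelˡ-≡ (c₁ i) (c₂ j) (c₂ j′)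
  ... | inj₂ (refl , e₁) = proper₁ i i′ e₁ ∘ +-cancelʳ-≡ (c₂ j) (c₁ i) (c₁ i′)

∈-edges⇒Edge : ∀ G {u v} → (u , v) ∈ edges G → Edge G u v
∈-edges⇒Edge G uv∈ =
  Equivalence.from T-≡ (proj₂ (∈-filter⁻ adjacent? {xs = allPairs} (proj₁ (∈-filter⁻ ascending? uv∈))))
  where
  allPairs : List (Fin (V G) × Fin (V G))
  allPairs = concatMap (λ u → map (λ v → (u , v)) (allFin (V G))) (allFin (V G))
  adjacent? : (e : Fin (V G) × Fin (V G)) → Dec (adj G (proj₁ e) (proj₂ e) ≡ true)
  adjacent? e = adj G (proj₁ e) (proj₂ e) ≟ᵇ true
  ascending? : (e : Fin (V G) × Fin (V G)) → Dec (toℕ (proj₁ e) < toℕ (proj₂ e))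
  ascending? e = toℕ (proj₁ e) <? toℕ (proj₂ e)

monoCount≡0 : ∀ G f → (∀ u v → Edge G u v → card (f u ⊕ f v) ≢ 1) → monoCount G f ≡ 0
monoCount≡0 G f not-mono =
  cong length (filter-none (λ e → card (f (proj₁ e) ⊕ f (proj₂ e)) ≟ 1) {xs = edges G}
    (All.tabulate λ {(u , v)} uv∈ → not-mono u v (∈-edges⇒Edge G uv∈)))

scale-injective : ∀ {n} (u v : Fin n) → n * toℕ u ≡ n * toℕ v → u ≡ v
scale-injective {suc n} u v eq = toℕ-injective (*-cancelˡ-≡ (toℕ u) (toℕ v) (suc n) eq)

module ColourLabelling (G : Graph) (c : Fin (V G) → Parity) where

  N : ℕ
  N = V G

  label : Parity → Fin N → FinSet
  label 0ℙ u = N * toℕ u ∷ []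
  label 1ℙ u = consecutive (toℕ u)

  labelling : Fin N → FinSet
  labelling u = label (c u) u

  edgeCode : Fin N → Fin N → Fin (N * N)
  edgeCode u v with c u
  ... | 0ℙ = combine u v
  ... | 1ℙ = combine v u

  ⊕-edge : ∀ {u v} → c u ≢ c v → labelling u ⊕ labelling v ≡ consecutive (toℕ (edgeCode u v))
  ⊕-edge {u} {v} cu≢cv with c u | c v
  ... | 0ℙ | 0ℙ = ⊥-elim (cu≢cv refl)
  ... | 0ℙ | 1ℙ = trans (singleton-⊕-consecutive (N * toℕ u) (toℕ v))
                        (cong consecutive (sym (toℕ-combine u v)))
  ... | 1ℙ | 0ℙ = cong consecutive (trans (+-comm (toℕ u) (N * toℕ v)) (sym (toℕ-combine v u)))
  ... | 1ℙ | 1ℙ = ⊥-elim (cu≢cv refl)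

  edgeCode-injective : ∀ {u v x y} → edgeCode u v ≡ edgeCode x y → (u ≡ x × v ≡ y) ⊎ (u ≡ y × v ≡ x)
  edgeCode-injective {u} {v} {x} {y} eq with c u | c x
  ... | 0ℙ | 0ℙ = inj₁ (combine-injective u v x y eq)
  ... | 0ℙ | 1ℙ = inj₂ (combine-injective u v y x eq)
  ... | 1ℙ | 0ℙ = inj₂ (swap (combine-injective v u x y eq))
  ... | 1ℙ | 1ℙ = inj₁ (swap (combine-injective v u y x eq))

  label-injective : ∀ p q u v → label p u ≈ˢ label q v → u ≡ v
  label-injective 0ℙ 0ℙ u v eq = scale-injective u v (singleton-injective eq)
  label-injective 0ℙ 1ℙ u v eq = ⊥-elim (singleton≉consecutive _ _ eq)
  label-injective 1ℙ 0ℙ u v eq = ⊥-elim (singleton≉consecutive _ _ (⇔-sym ∘ eq))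
  label-injective 1ℙ 1ℙ u v eq = toℕ-injective (consecutive-injective eq)

  label-nonempty : ∀ p u → label p u ≢ []
  label-nonempty 0ℙ u ()
  label-nonempty 1ℙ u ()

  card-edge : ∀ {u v} → c u ≢ c v → card (labelling u ⊕ labelling v) ≡ 2
  card-edge {u} {v} cu≢cv = trans (cong card (⊕-edge cu≢cv)) (card-consecutive (toℕ (edgeCode u v)))

  ⊔-card-edge : ∀ {u v} → c u ≢ c v → card (labelling u) ⊔ card (labelling v) ≡ 2
  ⊔-card-edge {u} {v} cu≢cv with c u | c v
  ... | 0ℙ | 0ℙ = ⊥-elim (cu≢cv refl)
  ... | 0ℙ | 1ℙ = cong (1 ⊔_) (card-consecutive (toℕ v))
  ... | 1ℙ | 0ℙ = cong (_⊔ 1) (card-consecutive (toℕ u))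
  ... | 1ℙ | 1ℙ = ⊥-elim (cu≢cv refl)

  weakIASI : ProperColouring G c → WeakIASI G labelling
  weakIASI proper = record
    { nonempty    = λ u → label-nonempty (c u) u
    ; injective   = λ u v → label-injective (c u) (c v) u v
    ; induced-inj = λ u v x y uv xy eq →
        edgeCode-injective (toℕ-injective (consecutive-injective
          (subst₂ _≈ˢ_ (⊕-edge (proper u v uv)) (⊕-edge (proper x y xy)) eq)))
    ; weak        = λ u v uv → trans (card-edge (proper u v uv)) (sym (⊔-card-edge (proper u v uv)))
    }

properColouring⇒isSparingNumber0 : ∀ G c → ProperColouring G c → IsSparingNumber G 0
properColouring⇒isSparingNumber0 G c proper =
  (labelling , weakIASI proper , monoCount≡0 G labelling λ u v uv → 1+n≢n ∘ trans (sym (card-edge (proper u v uv))))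
  , λ _ _ → z≤n
  where open ColourLabelling G c

theorem2p4 : (m n : ℕ) → 1 ≤ m → 1 ≤ n → IsSparingNumber (Grid m n) 0
theorem2p4 m n _ _ =
  properColouring⇒isSparingNumber0 (Grid m n) (□-colouring (Path m) (Path n) (parity ∘ toℕ) (parity ∘ toℕ))
    (□-properColouring {Path m} {Path n} (path-properColouring m) (path-properColouring n))
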